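{- The integrality gap of (LP-classic) for uniform capacitated facility location (CFL) with unit demands remains unbounded even after the addition of the submodular inequalities.
   Context: CFL with uniform capacity $U$ and unit-demand clients; (LP-classic): minimize $\sum_i f_iy_i+\sum_{i,j}c_{ij}x_{ij}$ subject to $x_{ij}\le y_i$, $\sum_i x_{ij}=1$ for all $j$, $\sum_j x_{ij}\le Uy_i$ for all $i$, $0\le y_i,x_{ij}\le1$. Submodular inequalities: for $I\subseteq F$, $J\subseteq C$, and $J_i\subseteq J$ for each $i\in I$, build a network with source $s$, an arc of capacity $\min\{U,|J_i|\}$ from $s$ to each facility node $i\in I$, unit-capacity arcs from $i$ to each client node $j\in J_i$, and unit-capacity arcs from each client node to sink $t$. Let $f(I)$ be the maximum $s$-$t$ flow value, $f(I\setminus\{i\})$ the maximum flow with arc $(s,i)$ capacity set to $0$, and $\rho_i(I\setminus\{i\})=f(I)-f(I\setminus\{i\})$. The inequality is $\sum_{i\in I}\sum_{j\in J_i}x_{ij}+\sum_{i\in I}\rho_i(I\setminus\{i\})(1-y_i)\le f(I)$. -}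

module Defs where

open import Data.Nat as ℕ using (ℕ; zero; suc)
open import Data.Fin using (Fin; zero; suc; _≟_)
open import Data.Fin.Subset using (Subset; inside; outside; _∈_; _⊆_; ∣_∣)
open import Data.Vec using (lookup)
open import Data.Integer using (+_)
open import Data.Rational using (ℚ; 0ℚ; 1ℚ; _+_; _*_; _-_; _≤_; _<_; _/_)
open import Data.Product using (Σ; _×_)
open import Data.Sum using (_⊎_)
open import Relation.Nullary using (¬_; does)
open import Relation.Binary.PropositionalEquality using (_≡_)
open import Data.Bool using (if_then_else_)

ℕtoℚ : ℕ → ℚ
ℕtoℚ n = + n / 1

Σℚ : (n : ℕ) → (Fin n → ℚ) → ℚ
Σℚ zero    g = 0ℚ
Σℚ (suc n) g = g zero + Σℚ n (λ k → g (suc k))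

ind : {n : ℕ} → Subset n → Fin n → ℚ
ind S k with lookup S k
... | inside  = 1ℚ
... | outside = 0ℚ

-- Facilities are Fin nF, clients Fin nC; costs are metric
-- (facilities and clients live in a common metric space, restricted to
-- the facility-client distances this means the standard
-- c i j ≤ c i j' + c i' j' + c i' j) and opening costs are nonnegative.

record Instance : Set where
  field
    nF nC : ℕ
    U     : ℕ
    f     : Fin nF → ℚ
    c     : Fin nF → Fin nC → ℚ
    f≥0   : ∀ i → 0ℚ ≤ f i
    c≥0   : ∀ i j → 0ℚ ≤ c i j
    metric : ∀ i i' j j' → c i j ≤ c i j' + c i' j' + c i' j

module _ (P : Instance) where
  open Instance P

  cost : (Fin nF → ℚ) → (Fin nF → Fin nC → ℚ) → ℚ
  cost y x = Σℚ nF (λ i → f i * y i) + Σℚ nF (λ i → Σℚ nC (λ j → c i j * x i j))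

  LPFeasible : (Fin nF → ℚ) → (Fin nF → Fin nC → ℚ) → Set
  LPFeasible y x =
    (∀ i j → x i j ≤ y i) ×
    (∀ j → Σℚ nF (λ i → x i j) ≡ 1ℚ) ×
    (∀ i → Σℚ nC (λ j → x i j) ≤ ℕtoℚ U * y i) ×
    (∀ i → 0ℚ ≤ y i × y i ≤ 1ℚ) ×
    (∀ i j → 0ℚ ≤ x i j × x i j ≤ 1ℚ)

  IsBin : ℚ → Set
  IsBin q = q ≡ 0ℚ ⊎ q ≡ 1ℚ

  IntFeasible : (Fin nF → ℚ) → (Fin nF → Fin nC → ℚ) → Set
  IntFeasible y x = LPFeasible y x × (∀ i → IsBin (y i)) × (∀ i j → IsBin (x i j))

  -- The flow network for (I, J, (J_i)): arcs s→i (i ∈ I) with capacity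
  -- cap i, unit arcs i→j for j ∈ J_i, unit arcs j→t.  A flow is given by
  -- its values φ i j on the middle arcs; by flow conservation the flow on
  -- s→i is Σ_j φ i j and on j→t is Σ_i φ i j.

  Arc : Subset nF → (Fin nF → Subset nC) → Fin nF → Fin nC → Set
  Arc I Js i j = i ∈ I × j ∈ Js i

  FeasibleFlow : (Fin nF → Fin nC → Set) → (Fin nF → ℚ) → (Fin nF → Fin nC → ℚ) → Set
  FeasibleFlow A cap φ =
    (∀ i j → 0ℚ ≤ φ i j) ×
    (∀ i j → ¬ A i j → φ i j ≡ 0ℚ) ×
    (∀ i j → φ i j ≤ 1ℚ) ×
    (∀ i → Σℚ nC (λ j → φ i j) ≤ cap i) ×
    (∀ j → Σℚ nF (λ i → φ i j) ≤ 1ℚ)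

  flowValue : (Fin nF → Fin nC → ℚ) → ℚ
  flowValue φ = Σℚ nF (λ i → Σℚ nC (λ j → φ i j))

  IsMaxFlow : (Fin nF → Fin nC → Set) → (Fin nF → ℚ) → ℚ → Set
  IsMaxFlow A cap v =
    Σ (Fin nF → Fin nC → ℚ) (λ φ → FeasibleFlow A cap φ × flowValue φ ≡ v) ×
    (∀ φ → FeasibleFlow A cap φ → flowValue φ ≤ v)

  capS : Subset nF → (Fin nF → Subset nC) → Fin nF → ℚ
  capS I Js i with lookup I i
  ... | inside  = ℕtoℚ (U ℕ.⊓ ∣ Js i ∣)
  ... | outside = 0ℚ

  capS-without : Subset nF → (Fin nF → Subset nC) → Fin nF → Fin nF → ℚ
  capS-without I Js i₀ i = if does (i₀ ≟ i) then 0ℚ else capS I Js i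

  -- (x,y) satisfies all submodular inequalities.
  -- fI = f(I), fI-i i = f(I \ {i}); ρ_i = fI - fI-i i.
  SatisfiesSubmodular : (Fin nF → ℚ) → (Fin nF → Fin nC → ℚ) → Set
  SatisfiesSubmodular y x =
    ∀ (I : Subset nF) (J : Subset nC) (Js : Fin nF → Subset nC) →
    (∀ i → i ∈ I → Js i ⊆ J) →
    ∀ (fI : ℚ) (fI-i : Fin nF → ℚ) →
    IsMaxFlow (Arc I Js) (capS I Js) fI →
    (∀ i → i ∈ I → IsMaxFlow (Arc I Js) (capS-without I Js i) (fI-i i)) →
    Σℚ nF (λ i → ind I i * Σℚ nC (λ j → ind (Js i) j * x i j))
      + Σℚ nF (λ i → ind I i * ((fI - fI-i i) * (1ℚ - y i)))
      ≤ fI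

module Submission where

-- For U ≥ 3 take a free facility A and two facilities B₁, B₂ of opening
-- cost 1, with U + 1 clients at distance 0 from all of them.  Any integral
-- solution must open B₁ or B₂ (A alone has capacity U), so it costs at
-- least 1.  The LP point y = (1, 2ε, 2ε), x_{A j} = 1 - 2ε, x_{Bₖ j} = ε
-- with ε = 1/(U + 1) costs 4ε, hence K times its cost is below 1 once
-- 4K ≤ U; Theorem 5 uses U = 3 + 4K.
--
-- The work is to check every submodular inequality at this point.  Its
-- ρ-terms involve max-flow values, which we never compute: a max-flow
-- value is bounded below by explicit flows (one avoiding B₁, one avoiding
-- B₂, sending 1 - ε from A and letting the other Bₖ act as backup) and
-- above by the cut at the clients.  Distinguishing how many of B₁, B₂
-- lie in I, the inequality reduces (one-facility-bound,
-- two-facilities-bound) to a sum over clients of finite estimates that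
-- depend only on which arcs reach the client (load-both, load-one,
-- load-none).

open import Defs
open import Data.Nat as ℕ using (ℕ; zero; suc)
import Data.Nat.Properties as ℕ
import Data.Nat.Coprimality as Coprimality
import Data.Integer as ℤ
import Data.Integer.Properties as ℤ
open import Data.Rational using (ℚ; mkℚ; 0ℚ; 1ℚ; _+_; _*_; _-_; _≤_; _<_; _/_; 1/_; -_; nonNegative)
open import Data.Rational.Properties
open import Data.Fin using (Fin; zero; suc) renaming (_≟_ to _≟ᶠ_)
open import Data.Fin.Subset using (Subset; _∈_; ∣_∣)
open import Data.Fin.Subset.Properties using (∣p∣≤n; _∈?_)
open import Data.Vec using ([]; _∷_; lookup)
open import Data.Vec.Properties using ([]=⇒lookup; lookup⇒[]=)
open import Data.Bool using (Bool; true; false; _∧_; _∨_)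
open import Data.Bool.Properties using (not-¬)
open import Data.Maybe using (Maybe; just; nothing)
open import Data.Product using (Σ; _×_; _,_; proj₁; proj₂)
open import Data.Sum using (inj₁; inj₂)
open import Data.Empty using (⊥; ⊥-elim)
open import Relation.Nullary using (¬_; yes; no)
open import Relation.Binary.PropositionalEquality
import Tactic.RingSolver.Core.AlmostCommutativeRing as ACR
open import Tactic.RingSolver using (solve-∀)
open import Algebra.Bundles using (CommutativeRing)
open import Algebra.Properties.Semiring.Sum (CommutativeRing.semiring +-*-commutativeRing)
  using (sum; sum-cong-≗; ∑-distrib-+; ∑-comm; *-distribˡ-sum)

ringℚ : ACR.AlmostCommutativeRing _ _
ringℚ = ACR.fromCommutativeRing +-*-commutativeRing isZero
  where
  isZero : (p : ℚ) → Maybe (0ℚ ≡ p)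
  isZero p with p ≟ 0ℚ
  ... | yes p≡0 = just (sym p≡0)
  ... | no  _   = nothing

≤-by : ∀ {p q} (d : ℚ) → 0ℚ ≤ d → q ≡ p + d → p ≤ q
≤-by {p} d 0≤d refl = subst (_≤ p + d) (+-identityʳ p) (+-monoʳ-≤ p 0≤d)

0≤+ : ∀ {p q} → 0ℚ ≤ p → 0ℚ ≤ q → 0ℚ ≤ p + q
0≤+ {p} {q} 0≤p 0≤q = ≤-trans 0≤p (≤-by q 0≤q refl)

0≤* : ∀ {p q} → 0ℚ ≤ p → 0ℚ ≤ q → 0ℚ ≤ p * q
0≤* {p} {q} 0≤p 0≤q = subst (_≤ p * q) (*-zeroˡ q) (*-monoʳ-≤-nonNeg q {{nonNegative 0≤q}} 0≤p)

0≤- : ∀ {p q} → p ≤ q → 0ℚ ≤ q - p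
0≤- {p} {q} p≤q = subst (_≤ q - p) (+-inverseʳ p) (+-monoˡ-≤ (- p) p≤q)

1-≤1 : ∀ {p} → 0ℚ ≤ p → 1ℚ - p ≤ 1ℚ
1-≤1 {p} 0≤p = ≤-by p 0≤p (identity p)
  where
  identity : ∀ p → 1ℚ ≡ (1ℚ - p) + p
  identity = solve-∀ ringℚ

0≤1 : 0ℚ ≤ 1ℚ
0≤1 = nonNegative⁻¹ 1ℚ

ℕtoℚ-as-mkℚ : ∀ m → ℕtoℚ m ≡ mkℚ (ℤ.+ m) 0 (Coprimality.sym (Coprimality.1-coprimeTo m))
ℕtoℚ-as-mkℚ m = normalize-coprime (Coprimality.sym (Coprimality.1-coprimeTo m))

ℕtoℚ-suc : ∀ m → ℕtoℚ (suc m) ≡ 1ℚ + ℕtoℚ m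
ℕtoℚ-suc m rewrite ℕtoℚ-as-mkℚ m =
  cong (_/ 1) (cong (ℤ._+_ (ℤ.+ 1)) (sym (ℤ.*-identityʳ (ℤ.+ m))))

ℕtoℚ-suc-* : ∀ m w → w + ℕtoℚ m * w ≡ ℕtoℚ (suc m) * w
ℕtoℚ-suc-* m w = trans (identity (ℕtoℚ m) w) (cong (_* w) (sym (ℕtoℚ-suc m)))
  where
  identity : ∀ a w → w + a * w ≡ (1ℚ + a) * w
  identity = solve-∀ ringℚ

ℕtoℚ-+ : ∀ m n → ℕtoℚ (m ℕ.+ n) ≡ ℕtoℚ m + ℕtoℚ n
ℕtoℚ-+ zero    n = sym (+-identityˡ (ℕtoℚ n))
ℕtoℚ-+ (suc m) n = begin
  ℕtoℚ (suc (m ℕ.+ n))        ≡⟨ ℕtoℚ-suc (m ℕ.+ n) ⟩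
  1ℚ + ℕtoℚ (m ℕ.+ n)         ≡⟨ cong (1ℚ +_) (ℕtoℚ-+ m n) ⟩
  1ℚ + (ℕtoℚ m + ℕtoℚ n)      ≡⟨ sym (+-assoc 1ℚ (ℕtoℚ m) (ℕtoℚ n)) ⟩
  (1ℚ + ℕtoℚ m) + ℕtoℚ n      ≡⟨ cong (_+ ℕtoℚ n) (sym (ℕtoℚ-suc m)) ⟩
  ℕtoℚ (suc m) + ℕtoℚ n       ∎
  where open ≡-Reasoning

ℕtoℚ-* : ∀ m n → ℕtoℚ (m ℕ.* n) ≡ ℕtoℚ m * ℕtoℚ n
ℕtoℚ-* zero    n = sym (*-zeroˡ (ℕtoℚ n))
ℕtoℚ-* (suc m) n = begin
  ℕtoℚ (n ℕ.+ m ℕ.* n)        ≡⟨ ℕtoℚ-+ n (m ℕ.* n) ⟩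
  ℕtoℚ n + ℕtoℚ (m ℕ.* n)     ≡⟨ cong (ℕtoℚ n +_) (ℕtoℚ-* m n) ⟩
  ℕtoℚ n + ℕtoℚ m * ℕtoℚ n    ≡⟨ ℕtoℚ-suc-* m (ℕtoℚ n) ⟩
  ℕtoℚ (suc m) * ℕtoℚ n       ∎
  where open ≡-Reasoning

ℕtoℚ-nonNeg : ∀ m → 0ℚ ≤ ℕtoℚ m
ℕtoℚ-nonNeg m = nonNegative⁻¹ (ℕtoℚ m) {{normalize-nonNeg m 1}}

ℕtoℚ-mono : ∀ {m n} → m ℕ.≤ n → ℕtoℚ m ≤ ℕtoℚ n
ℕtoℚ-mono {m} m≤n with ℕ.m≤n⇒∃[o]m+o≡n m≤n
... | k , refl = ≤-by (ℕtoℚ k) (ℕtoℚ-nonNeg k) (ℕtoℚ-+ m k)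

Σℚ≡sum : ∀ n (g : Fin n → ℚ) → Σℚ n g ≡ sum g
Σℚ≡sum zero    g = refl
Σℚ≡sum (suc n) g = cong (g zero +_) (Σℚ≡sum n (λ k → g (suc k)))

Σ-cong : ∀ n {f g : Fin n → ℚ} → (∀ j → f j ≡ g j) → Σℚ n f ≡ Σℚ n g
Σ-cong n {f} {g} f≗g = trans (Σℚ≡sum n f) (trans (sum-cong-≗ f≗g) (sym (Σℚ≡sum n g)))

Σ-+ : ∀ n (f g : Fin n → ℚ) → Σℚ n (λ j → f j + g j) ≡ Σℚ n f + Σℚ n g
Σ-+ n f g = begin
  Σℚ n (λ j → f j + g j)   ≡⟨ Σℚ≡sum n _ ⟩
  sum (λ j → f j + g j)    ≡⟨ ∑-distrib-+ f g ⟩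
  sum f + sum g            ≡⟨ sym (cong₂ _+_ (Σℚ≡sum n f) (Σℚ≡sum n g)) ⟩
  Σℚ n f + Σℚ n g          ∎
  where open ≡-Reasoning

Σ-*ˡ : ∀ n c (f : Fin n → ℚ) → c * Σℚ n f ≡ Σℚ n (λ j → c * f j)
Σ-*ˡ n c f = begin
  c * Σℚ n f               ≡⟨ cong (c *_) (Σℚ≡sum n f) ⟩
  c * sum f                ≡⟨ *-distribˡ-sum c f ⟩
  sum (λ j → c * f j)      ≡⟨ sym (Σℚ≡sum n _) ⟩
  Σℚ n (λ j → c * f j)     ∎
  where open ≡-Reasoning

Σ-swap : ∀ m n (f : Fin m → Fin n → ℚ) →
         Σℚ m (λ i → Σℚ n (f i)) ≡ Σℚ n (λ j → Σℚ m (λ i → f i j))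
Σ-swap m n f = begin
  Σℚ m (λ i → Σℚ n (f i))            ≡⟨ Σ-cong m (λ i → Σℚ≡sum n (f i)) ⟩
  Σℚ m (λ i → sum (f i))             ≡⟨ Σℚ≡sum m _ ⟩
  sum (λ i → sum (f i))              ≡⟨ ∑-comm f ⟩
  sum (λ j → sum (λ i → f i j))      ≡⟨ sym (Σℚ≡sum n _) ⟩
  Σℚ n (λ j → sum (λ i → f i j))     ≡⟨ sym (Σ-cong n (λ j → Σℚ≡sum m (λ i → f i j))) ⟩
  Σℚ n (λ j → Σℚ m (λ i → f i j))    ∎
  where open ≡-Reasoning

Σ-mono : ∀ n {f g : Fin n → ℚ} → (∀ j → f j ≤ g j) → Σℚ n f ≤ Σℚ n g
Σ-mono zero    f≤g = ≤-refl
Σ-mono (suc n) f≤g = +-mono-≤ (f≤g zero) (Σ-mono n (λ j → f≤g (suc j)))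

Σ-const : ∀ n c → Σℚ n (λ _ → c) ≡ ℕtoℚ n * c
Σ-const zero    c = sym (*-zeroˡ c)
Σ-const (suc n) c = trans (cong (c +_) (Σ-const n c)) (ℕtoℚ-suc-* n c)

Σ-zero : ∀ n → Σℚ n (λ _ → 0ℚ) ≡ 0ℚ
Σ-zero n = trans (Σ-const n 0ℚ) (*-zeroʳ (ℕtoℚ n))

Σ-0* : ∀ n (f : Fin n → ℚ) → Σℚ n (λ j → 0ℚ * f j) ≡ 0ℚ
Σ-0* n f = trans (sym (Σ-*ˡ n 0ℚ f)) (*-zeroˡ (Σℚ n f))

Σ-linear : ∀ n p q (f g : Fin n → ℚ) → Σℚ n (λ j → p * f j + q * g j) ≡ p * Σℚ n f + q * Σℚ n g
Σ-linear n p q f g = trans (Σ-+ n _ _) (sym (cong₂ _+_ (Σ-*ˡ n p f) (Σ-*ˡ n q g)))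

infixr 8 _·_
_·_ : Bool → ℚ → ℚ
true  · p = p
false · p = 0ℚ

ind-* : ∀ {m} (S : Subset m) k p → ind S k * p ≡ lookup S k · p
ind-* S k p with lookup S k
... | true  = *-identityˡ p
... | false = *-zeroˡ p

·-∧ : ∀ a b p → a · b · p ≡ (a ∧ b) · p
·-∧ true  b p = refl
·-∧ false b p = refl

Σ-members : ∀ {m} (p : Subset m) w → Σℚ m (λ j → lookup p j · w) ≡ ℕtoℚ ∣ p ∣ * w
Σ-members []          w = sym (*-zeroˡ w)
Σ-members (true  ∷ p) w = trans (cong (w +_) (Σ-members p w)) (ℕtoℚ-suc-* ∣ p ∣ w)
Σ-members (false ∷ p) w = trans (+-identityˡ _) (Σ-members p w)

-- The two shapes of linear reasoning that turn flow and cut bounds into a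
-- submodular inequality S + Σₖ ρₖ (1 - y) ≤ g.  Here S is its x-part, g plays
-- f(I), fₖ plays f(I \ {Bₖ}) (so ρₖ = g - fₖ), y is the opening value of
-- the Bₖ, Vₖ, W are values of explicit flows and C is a cut bound.

one-facility-bound : ∀ {y S V W f g} → 0ℚ ≤ y → 0ℚ ≤ 1ℚ - y → V ≤ f → W ≤ g →
                     S ≤ y * W + (1ℚ - y) * V → S + (g - f) * (1ℚ - y) ≤ g
one-facility-bound {y} {S} {V} {W} {f} {g} 0≤y 0≤1-y V≤f W≤g S≤ =
  ≤-by (y * (g - W) + ((1ℚ - y) * (f - V) + ((y * W + (1ℚ - y) * V) - S)))
       (0≤+ (0≤* 0≤y (0≤- W≤g)) (0≤+ (0≤* 0≤1-y (0≤- V≤f)) (0≤- S≤)))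
       (identity y S V W f g)
  where
  identity : ∀ y S V W f g → g ≡ (S + (g - f) * (1ℚ - y)) +
             (y * (g - W) + ((1ℚ - y) * (f - V) + ((y * W + (1ℚ - y) * V) - S)))
  identity = solve-∀ ringℚ

-- Two ρ-terms: now g enters the left side with the positive coefficient
-- 1 - 2y, so it is replaced by an upper (cut) bound C ≥ g.
two-facilities-bound : ∀ {y S V₁ V₂ f₁ f₂ g C} → 0ℚ ≤ 1ℚ - y → 0ℚ ≤ 1ℚ - (y + y) →
                       V₁ ≤ f₁ → V₂ ≤ f₂ → g ≤ C →
                       S + (1ℚ - (y + y)) * C ≤ (1ℚ - y) * V₁ + (1ℚ - y) * V₂ →
                       S + ((g - f₁) * (1ℚ - y) + (g - f₂) * (1ℚ - y)) ≤ g
two-facilities-bound {y} {S} {V₁} {V₂} {f₁} {f₂} {g} {C} 0≤1-y 0≤1-2y V₁≤f₁ V₂≤f₂ g≤C S≤ =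
  ≤-by ((1ℚ - y) * (f₁ - V₁) + ((1ℚ - y) * (f₂ - V₂) + ((1ℚ - (y + y)) * (C - g) +
          (((1ℚ - y) * V₁ + (1ℚ - y) * V₂) - (S + (1ℚ - (y + y)) * C)))))
       (0≤+ (0≤* 0≤1-y (0≤- V₁≤f₁))
            (0≤+ (0≤* 0≤1-y (0≤- V₂≤f₂)) (0≤+ (0≤* 0≤1-2y (0≤- g≤C)) (0≤- S≤))))
       (identity y S V₁ V₂ f₁ f₂ g C)
  where
  identity : ∀ y S V₁ V₂ f₁ f₂ g C → g ≡ (S + ((g - f₁) * (1ℚ - y) + (g - f₂) * (1ℚ - y))) +
             ((1ℚ - y) * (f₁ - V₁) + ((1ℚ - y) * (f₂ - V₂) + ((1ℚ - (y + y)) * (C - g) +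
               (((1ℚ - y) * V₁ + (1ℚ - y) * V₂) - (S + (1ℚ - (y + y)) * C)))))
  identity = solve-∀ ringℚ

module GapInstance (U : ℕ) (3≤U : 3 ℕ.≤ U) where

  n : ℕ
  n = suc U

  u : ℚ
  u = ℕtoℚ U

  -- ε = 1/N with N = U + 1 written as a normalised rational
  N ε : ℚ
  N = mkℚ (ℤ.+ n) 0 (Coprimality.sym (Coprimality.1-coprimeTo n))
  ε = 1/ N

  [1+u]ε≡1 : (1ℚ + u) * ε ≡ 1ℚ
  [1+u]ε≡1 = begin
    (1ℚ + u) * ε      ≡⟨ cong (_* ε) (sym (ℕtoℚ-suc U)) ⟩
    ℕtoℚ n * ε        ≡⟨ cong (_* ε) (ℕtoℚ-as-mkℚ n) ⟩
    N * ε             ≡⟨ *-inverseʳ N ⟩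
    1ℚ                ∎
    where open ≡-Reasoning

  mod-[1+u]ε : ∀ {p q} k → p ≡ q + k * ((1ℚ + u) * ε - 1ℚ) → p ≡ q
  mod-[1+u]ε {p} {q} k p≡ = trans p≡ (trans (cong (λ z → q + k * (z - 1ℚ)) [1+u]ε≡1) (vanish q k))
    where
    vanish : ∀ q k → q + k * (1ℚ - 1ℚ) ≡ q
    vanish = solve-∀ ringℚ

  Σ-clients : ∀ c → Σℚ n (λ _ → c) ≡ (1ℚ + u) * c
  Σ-clients c = trans (Σ-const n c) (cong (_* c) (ℕtoℚ-suc U))

  ε>0 : 0ℚ < ε
  ε>0 = positive⁻¹ ε

  ε≥0 : 0ℚ ≤ ε
  ε≥0 = <⇒≤ ε>0

  1≤u : 1ℚ ≤ u
  1≤u = ℕtoℚ-mono (ℕ.≤-trans (ℕ.s≤s ℕ.z≤n) 3≤U)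

  yB xA : ℚ
  yB = ε + ε
  xA = 1ℚ - yB

  2yB≤1 : yB + yB ≤ 1ℚ
  2yB≤1 = ≤-by ((u - ℕtoℚ 3) * ε) (0≤* (0≤- (ℕtoℚ-mono 3≤U)) ε≥0)
                (trans (sym [1+u]ε≡1) (identity u ε))
    where
    identity : ∀ u e → (1ℚ + u) * e ≡ ((e + e) + (e + e)) + (u - (1ℚ + 1ℚ + 1ℚ)) * e
    identity = solve-∀ ringℚ

  0≤yB : 0ℚ ≤ yB
  0≤yB = 0≤+ ε≥0 ε≥0

  yB≤1 : yB ≤ 1ℚ
  yB≤1 = ≤-trans (≤-by yB 0≤yB refl) 2yB≤1

  0≤xA : 0ℚ ≤ xA
  0≤xA = 0≤- yB≤1

  0≤1-2yB : 0ℚ ≤ 1ℚ - (yB + yB)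
  0≤1-2yB = 0≤- 2yB≤1

  ε≤1-ε : ε ≤ 1ℚ - ε
  ε≤1-ε = ≤-by xA 0≤xA (identity ε)
    where
    identity : ∀ e → 1ℚ - e ≡ e + (1ℚ - (e + e))
    identity = solve-∀ ringℚ

  0≤1-ε : 0ℚ ≤ 1ℚ - ε
  0≤1-ε = ≤-trans ε≥0 ε≤1-ε

  pattern A  = zero
  pattern B₁ = suc zero
  pattern B₂ = suc (suc zero)

  opening : Fin 3 → ℚ
  opening A       = 0ℚ
  opening (suc _) = 1ℚ

  P : Instance
  P = record
    { nF = 3 ; nC = n ; U = U
    ; f = opening ; c = λ _ _ → 0ℚ
    ; f≥0 = opening≥0 ; c≥0 = λ _ _ → ≤-refl ; metric = λ _ _ _ _ → ≤-refl }
    where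
    opening≥0 : ∀ i → 0ℚ ≤ opening i
    opening≥0 A       = ≤-refl
    opening≥0 (suc _) = 0≤1

  cost≡ : ∀ y x → cost P y x ≡ y B₁ + y B₂
  cost≡ y x = begin
    cost P y x
      ≡⟨ cong (Σℚ 3 (λ i → opening i * y i) +_) (trans (Σ-cong 3 (λ i → Σ-0* n (x i))) (Σ-zero 3)) ⟩
    (0ℚ * y A + (1ℚ * y B₁ + (1ℚ * y B₂ + 0ℚ))) + 0ℚ
      ≡⟨ identity (y A) (y B₁) (y B₂) ⟩
    y B₁ + y B₂ ∎
    where
    open ≡-Reasoning
    identity : ∀ a b c → (0ℚ * a + (1ℚ * b + (1ℚ * c + 0ℚ))) + 0ℚ ≡ b + c
    identity = solve-∀ ringℚ

  yLP : Fin 3 → ℚ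
  yLP A       = 1ℚ
  yLP (suc _) = yB

  xLP : Fin 3 → Fin n → ℚ
  xLP A       _ = xA
  xLP (suc _) _ = ε

  LP-feasible : LPFeasible P yLP xLP
  LP-feasible = x≤y , demand , capacity , y-bounds , x-bounds
    where
    ε≤yB : ε ≤ yB
    ε≤yB = ≤-by ε ε≥0 refl
    x≤y : ∀ i j → xLP i j ≤ yLP i
    x≤y A       _ = 1-≤1 0≤yB
    x≤y (suc _) _ = ε≤yB
    demand : ∀ j → Σℚ 3 (λ i → xLP i j) ≡ 1ℚ
    demand _ = identity ε
      where
      identity : ∀ e → (1ℚ - (e + e)) + (e + (e + 0ℚ)) ≡ 1ℚ
      identity = solve-∀ ringℚ
    -- A serves (U + 1)(1 - 2ε) = U - 1, each Bₖ serves (U + 1)ε = 1 ≤ 2Uε.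
    capacity : ∀ i → Σℚ n (λ j → xLP i j) ≤ u * yLP i
    capacity A = subst (_≤ u * 1ℚ) (sym (Σ-clients xA)) (≤-by 1ℚ 0≤1 (mod-[1+u]ε (1ℚ + 1ℚ) (identity u ε)))
      where
      identity : ∀ u e → u * 1ℚ ≡ ((1ℚ + u) * (1ℚ - (e + e)) + 1ℚ) + (1ℚ + 1ℚ) * ((1ℚ + u) * e - 1ℚ)
      identity = solve-∀ ringℚ
    capacity (suc _) = subst (_≤ u * yB) (sym (Σ-clients ε)) (≤-by xA 0≤xA (mod-[1+u]ε 1ℚ (identity u ε)))
      where
      identity : ∀ u e → u * (e + e) ≡ ((1ℚ + u) * e + (1ℚ - (e + e))) + 1ℚ * ((1ℚ + u) * e - 1ℚ)
      identity = solve-∀ ringℚ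
    y-bounds : ∀ i → 0ℚ ≤ yLP i × yLP i ≤ 1ℚ
    y-bounds A       = 0≤1 , ≤-refl
    y-bounds (suc _) = 0≤yB , yB≤1
    x-bounds : ∀ i j → 0ℚ ≤ xLP i j × xLP i j ≤ 1ℚ
    x-bounds A       _ = 0≤xA , 1-≤1 0≤yB
    x-bounds (suc _) _ = ε≥0 , ≤-trans ε≤yB yB≤1

  yInt : Fin 3 → ℚ
  yInt _ = 1ℚ

  xInt : Fin 3 → Fin n → ℚ
  xInt A  zero    = 0ℚ
  xInt A  (suc _) = 1ℚ
  xInt B₁ zero    = 1ℚ
  xInt B₁ (suc _) = 0ℚ
  xInt B₂ _       = 0ℚ

  Int-feasible : IntFeasible P yInt xInt
  Int-feasible = (x≤y , demand , capacity , (λ _ → 0≤1 , ≤-refl) , x-bounds) , (λ _ → inj₂ refl) , binary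
    where
    x-bounds : ∀ i j → 0ℚ ≤ xInt i j × xInt i j ≤ 1ℚ
    x-bounds A  zero    = ≤-refl , 0≤1
    x-bounds A  (suc _) = 0≤1 , ≤-refl
    x-bounds B₁ zero    = 0≤1 , ≤-refl
    x-bounds B₁ (suc _) = ≤-refl , 0≤1
    x-bounds B₂ _       = ≤-refl , 0≤1
    x≤y : ∀ i j → xInt i j ≤ yInt i
    x≤y i j = proj₂ (x-bounds i j)
    demand : ∀ j → Σℚ 3 (λ i → xInt i j) ≡ 1ℚ
    demand zero    = refl
    demand (suc _) = refl
    u≤u*1 : ∀ {p} → p ≤ u → p ≤ u * yInt A
    u≤u*1 {p} = subst (p ≤_) (sym (*-identityʳ u))
    capacity : ∀ i → Σℚ n (xInt i) ≤ u * yInt i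
    capacity A  = u≤u*1 (≤-reflexive (trans (+-identityˡ _) (trans (Σ-const U 1ℚ) (*-identityʳ u))))
    capacity B₁ = u≤u*1 (subst (_≤ u) (sym (trans (cong (1ℚ +_) (Σ-zero U)) (+-identityʳ 1ℚ))) 1≤u)
    capacity B₂ = u≤u*1 (subst (_≤ u) (sym (Σ-zero n)) (≤-trans 0≤1 1≤u))
    binary : ∀ i j → IsBin P (xInt i j)
    binary A  zero    = inj₁ refl
    binary A  (suc _) = inj₂ refl
    binary B₁ zero    = inj₂ refl
    binary B₁ (suc _) = inj₁ refl
    binary B₂ _       = inj₁ refl

  A-alone-insufficient : ∀ y x → LPFeasible P y x → y B₁ ≡ 0ℚ → y B₂ ≡ 0ℚ → ⊥
  A-alone-insufficient y x (x≤y , demand , capacity , y-bounds , _) y₁≡0 y₂≡0 =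
    <-irrefl refl (<-≤-trans (positive⁻¹ 1ℚ) 1≤0)
    where
    A-serves-all : ∀ j → 1ℚ ≤ x A j
    A-serves-all j = subst₂ _≤_ (demand j) (+-identityʳ (x A j))
      (+-monoʳ-≤ (x A j) (+-mono-≤ (subst (x B₁ j ≤_) y₁≡0 (x≤y B₁ j))
                                   (+-mono-≤ (subst (x B₂ j ≤_) y₂≡0 (x≤y B₂ j)) ≤-refl)))
    1+u≤u : (1ℚ + u) * 1ℚ ≤ u * 1ℚ
    1+u≤u = subst (_≤ u * 1ℚ) (Σ-clients 1ℚ)
      (≤-trans (Σ-mono n A-serves-all)
        (≤-trans (capacity A) (*-monoˡ-≤-nonNeg u {{nonNegative (≤-trans 0≤1 1≤u)}} (proj₂ (y-bounds A)))))
    1≤0 : 1ℚ ≤ 0ℚ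
    1≤0 = subst₂ _≤_ (cancel u) (+-inverseʳ (u * 1ℚ)) (+-monoˡ-≤ (- (u * 1ℚ)) 1+u≤u)
      where
      cancel : ∀ u → (1ℚ + u) * 1ℚ - u * 1ℚ ≡ 1ℚ
      cancel = solve-∀ ringℚ

  integral-cost≥1 : ∀ y x → IntFeasible P y x → 1ℚ ≤ cost P y x
  integral-cost≥1 y x (feasible , y-binary , _) =
    subst (1ℚ ≤_) (sym (cost≡ y x)) (opens-some (y-binary B₁) (y-binary B₂))
    where
    y≥0 : ∀ i → 0ℚ ≤ y i
    y≥0 i = proj₁ (proj₁ (proj₂ (proj₂ (proj₂ feasible))) i)
    opens-some : IsBin P (y B₁) → IsBin P (y B₂) → 1ℚ ≤ y B₁ + y B₂
    opens-some (inj₂ y₁≡1) _           = ≤-by (y B₂) (y≥0 B₂) (cong (_+ y B₂) y₁≡1)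
    opens-some (inj₁ _)    (inj₂ y₂≡1) = ≤-by (y B₁) (y≥0 B₁)
                                           (trans (cong (y B₁ +_) y₂≡1) (+-comm (y B₁) 1ℚ))
    opens-some (inj₁ y₁≡0) (inj₁ y₂≡0) = ⊥-elim (A-alone-insufficient y x feasible y₁≡0 y₂≡0)

  primary : Bool → ℚ
  primary b = b · (1ℚ - ε)

  backup : Bool → Bool → ℚ
  backup _     false = 0ℚ
  backup true  true  = ε
  backup false true  = 1ℚ - ε

  -- what a client with arcs a (from A) and b (from the backup) receives
  served : Bool → Bool → ℚ
  served a b = primary a + backup a b

  0≤primary : ∀ b → 0ℚ ≤ primary b
  0≤primary true  = 0≤1-ε
  0≤primary false = ≤-refl

  primary≤1 : ∀ b → primary b ≤ 1ℚ
  primary≤1 true  = 1-≤1 ε≥0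
  primary≤1 false = 0≤1

  backup-bounds : ∀ a b → 0ℚ ≤ backup a b × backup a b ≤ primary b
  backup-bounds _     false = ≤-refl , ≤-refl
  backup-bounds true  true  = ε≥0 , ε≤1-ε
  backup-bounds false true  = 0≤1-ε , ≤-refl

  served≤1 : ∀ a b → served a b ≤ 1ℚ
  served≤1 true  true  = ≤-reflexive (identity ε)
    where
    identity : ∀ e → (1ℚ - e) + e ≡ 1ℚ
    identity = solve-∀ ringℚ
  served≤1 true  false = subst (_≤ 1ℚ) (sym (+-identityʳ (1ℚ - ε))) (1-≤1 ε≥0)
  served≤1 false true  = subst (_≤ 1ℚ) (sym (+-identityˡ (1ℚ - ε))) (1-≤1 ε≥0)
  served≤1 false false = 0≤1

  rate-fits : ∀ m → m ℕ.≤ n → ℕtoℚ m * (1ℚ - ε) ≤ ℕtoℚ (U ℕ.⊓ m)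
  rate-fits m m≤n with m ℕ.≤? U
  ... | yes m≤U = subst (ℕtoℚ m * (1ℚ - ε) ≤_) (cong ℕtoℚ (sym (ℕ.m≥n⇒m⊓n≡n m≤U)))
                        (≤-by (ℕtoℚ m * ε) (0≤* (ℕtoℚ-nonNeg m) ε≥0) (identity (ℕtoℚ m) ε))
    where
    identity : ∀ m e → m ≡ m * (1ℚ - e) + m * e
    identity = solve-∀ ringℚ
  ... | no  m≰U rewrite ℕ.≤-antisym m≤n (ℕ.≰⇒> m≰U) | ℕ.m≤n⇒m⊓n≡m (ℕ.n≤1+n U) =
    ≤-reflexive (trans (cong (_* (1ℚ - ε)) (ℕtoℚ-suc U)) (mod-[1+u]ε (- 1ℚ) (identity u ε)))
    where
    identity : ∀ u e → (1ℚ + u) * (1ℚ - e) ≡ u + (- 1ℚ) * ((1ℚ + u) * e - 1ℚ)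
    identity = solve-∀ ringℚ

  -- The x-part of a submodular inequality at one client whose arcs from
  -- A, B₁, B₂ are present according to a, b₁, b₂.
  load : Bool → Bool → Bool → ℚ
  load a b₁ b₂ = a · xA + (b₁ · ε + (b₂ · ε + 0ℚ))

  0≤2ε² : 0ℚ ≤ ε * ε + ε * ε
  0≤2ε² = 0≤+ (0≤* ε≥0 ε≥0) (0≤* ε≥0 ε≥0)

  -- Both B₁, B₂ ∈ I, compared with (1 - 2ε) times the two explicit flows.
  -- Slack by (a, b₁, b₂): (1,1,1) 0, (1,1,0) and (1,0,1) 2ε², (1,0,0) 4ε²,
  -- (0,1,1) (1 - 2ε)², (0,1,0) and (0,0,1) 2ε², (0,0,0) 0.
  load-both : ∀ a b₁ b₂ → load a b₁ b₂ + (1ℚ - (yB + yB)) * ((a ∨ (b₁ ∨ b₂)) · 1ℚ)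
                          ≤ xA * served a b₂ + xA * served a b₁
  load-both true  true  true  = ≤-by 0ℚ ≤-refl (identity ε)
    where
    identity : ∀ e → (1ℚ - (e + e)) * ((1ℚ - e) + e) + (1ℚ - (e + e)) * ((1ℚ - e) + e)
                   ≡ ((1ℚ - (e + e)) + (e + (e + 0ℚ))) + (1ℚ - ((e + e) + (e + e))) * 1ℚ + 0ℚ
    identity = solve-∀ ringℚ
  load-both true  true  false = ≤-by (ε * ε + ε * ε) 0≤2ε² (identity ε)
    where
    identity : ∀ e → (1ℚ - (e + e)) * ((1ℚ - e) + 0ℚ) + (1ℚ - (e + e)) * ((1ℚ - e) + e)
                   ≡ ((1ℚ - (e + e)) + (e + 0ℚ)) + (1ℚ - ((e + e) + (e + e))) * 1ℚ + (e * e + e * e)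
    identity = solve-∀ ringℚ
  load-both true  false true  = ≤-by (ε * ε + ε * ε) 0≤2ε² (identity ε)
    where
    identity : ∀ e → (1ℚ - (e + e)) * ((1ℚ - e) + e) + (1ℚ - (e + e)) * ((1ℚ - e) + 0ℚ)
                   ≡ ((1ℚ - (e + e)) + (0ℚ + (e + 0ℚ))) + (1ℚ - ((e + e) + (e + e))) * 1ℚ + (e * e + e * e)
    identity = solve-∀ ringℚ
  load-both true  false false = ≤-by ((ε * ε + ε * ε) + (ε * ε + ε * ε)) (0≤+ 0≤2ε² 0≤2ε²) (identity ε)
    where
    identity : ∀ e → (1ℚ - (e + e)) * ((1ℚ - e) + 0ℚ) + (1ℚ - (e + e)) * ((1ℚ - e) + 0ℚ)
                   ≡ ((1ℚ - (e + e)) + 0ℚ) + (1ℚ - ((e + e) + (e + e))) * 1ℚ + ((e * e + e * e) + (e * e + e * e))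
    identity = solve-∀ ringℚ
  load-both false true  true  = ≤-by (xA * xA) (0≤* 0≤xA 0≤xA) (identity ε)
    where
    identity : ∀ e → (1ℚ - (e + e)) * (0ℚ + (1ℚ - e)) + (1ℚ - (e + e)) * (0ℚ + (1ℚ - e))
                   ≡ (0ℚ + (e + (e + 0ℚ))) + (1ℚ - ((e + e) + (e + e))) * 1ℚ + ((1ℚ - (e + e)) * (1ℚ - (e + e)))
    identity = solve-∀ ringℚ
  load-both false true  false = ≤-by (ε * ε + ε * ε) 0≤2ε² (identity ε)
    where
    identity : ∀ e → (1ℚ - (e + e)) * 0ℚ + (1ℚ - (e + e)) * (0ℚ + (1ℚ - e))
                   ≡ (0ℚ + (e + 0ℚ)) + (1ℚ - ((e + e) + (e + e))) * 1ℚ + (e * e + e * e)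
    identity = solve-∀ ringℚ
  load-both false false true  = ≤-by (ε * ε + ε * ε) 0≤2ε² (identity ε)
    where
    identity : ∀ e → (1ℚ - (e + e)) * (0ℚ + (1ℚ - e)) + (1ℚ - (e + e)) * 0ℚ
                   ≡ (0ℚ + (0ℚ + (e + 0ℚ))) + (1ℚ - ((e + e) + (e + e))) * 1ℚ + (e * e + e * e)
    identity = solve-∀ ringℚ
  load-both false false false = ≤-by 0ℚ ≤-refl (identity ε)
    where
    identity : ∀ e → (1ℚ - (e + e)) * 0ℚ + (1ℚ - (e + e)) * 0ℚ
                   ≡ 0ℚ + (1ℚ - ((e + e) + (e + e))) * 0ℚ + 0ℚ
    identity = solve-∀ ringℚ

  -- Exactly one Bₖ ∈ I, with arcs b; the other contributes nothing.
  -- Slack by (a, b): (1,1) 2ε², (1,0) ε, (0,1) ε(1 - 2ε), (0,0) 0.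
  load-one : ∀ a b → load a b false ≤ yB * served a b + xA * served a false
  load-one true  true  = ≤-by (ε * ε + ε * ε) 0≤2ε² (identity ε)
    where
    identity : ∀ e → (e + e) * ((1ℚ - e) + e) + (1ℚ - (e + e)) * ((1ℚ - e) + 0ℚ)
                   ≡ ((1ℚ - (e + e)) + (e + 0ℚ)) + (e * e + e * e)
    identity = solve-∀ ringℚ
  load-one true  false = ≤-by ε ε≥0 (identity ε)
    where
    identity : ∀ e → (e + e) * ((1ℚ - e) + 0ℚ) + (1ℚ - (e + e)) * ((1ℚ - e) + 0ℚ)
                   ≡ ((1ℚ - (e + e)) + 0ℚ) + e
    identity = solve-∀ ringℚ
  load-one false true  = ≤-by (ε * xA) (0≤* ε≥0 0≤xA) (identity ε)
    where
    identity : ∀ e → (e + e) * (0ℚ + (1ℚ - e)) + (1ℚ - (e + e)) * 0ℚ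
                   ≡ (0ℚ + (e + 0ℚ)) + (e * (1ℚ - (e + e)))
    identity = solve-∀ ringℚ
  load-one false false = ≤-by 0ℚ ≤-refl (identity ε)
    where
    identity : ∀ e → (e + e) * 0ℚ + (1ℚ - (e + e)) * 0ℚ
                   ≡ 0ℚ + 0ℚ
    identity = solve-∀ ringℚ

  -- Neither B₁ nor B₂ ∈ I.  Slack ε if a, else 0.
  load-none : ∀ a → load a false false ≤ served a false
  load-none true  = ≤-by ε ε≥0 (identity ε)
    where
    identity : ∀ e → (1ℚ - e) + 0ℚ ≡ ((1ℚ - (e + e)) + 0ℚ) + e
    identity = solve-∀ ringℚ
  load-none false = ≤-refl

  module Network (I : Subset 3) (Js : Fin 3 → Subset n) where

    arc : Fin 3 → Fin n → Bool
    arc i j = lookup I i ∧ lookup (Js i) j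

    Arc⇒arc : ∀ {i j} → Arc P I Js i j → arc i j ≡ true
    Arc⇒arc (i∈I , j∈Jᵢ) rewrite []=⇒lookup i∈I | []=⇒lookup j∈Jᵢ = refl

    no-Arc⇒no-arc : ∀ {i j} → ¬ Arc P I Js i j → arc i j ≡ false
    no-Arc⇒no-arc {i} {j} ¬arc with lookup I i in i∈I | lookup (Js i) j in j∈Jᵢ
    ... | true  | true  = ⊥-elim (¬arc (lookup⇒[]= i I i∈I , lookup⇒[]= j (Js i) j∈Jᵢ))
    ... | true  | false = refl
    ... | false | _     = refl

    ∉⇒outside : ∀ {i} → ¬ i ∈ I → lookup I i ≡ false
    ∉⇒outside {i} i∉I with lookup I i in i∈I
    ... | true  = ⊥-elim (i∉I (lookup⇒[]= i I i∈I))
    ... | false = refl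

    outside⇒no-arc : ∀ {i} → lookup I i ≡ false → ∀ j → arc i j ≡ false
    outside⇒no-arc {i} i∉I j = cong (_∧ lookup (Js i) j) i∉I

    no-flow : ∀ {cap φ} → FeasibleFlow P (Arc P I Js) cap φ → ∀ {i j} → arc i j ≡ false → φ i j ≡ 0ℚ
    no-flow (_ , off-arc , _) {i} {j} no-arc = off-arc i j (λ a → not-¬ (Arc⇒arc a) no-arc)

    primary≤capS : ∀ i → Σℚ n (λ j → primary (arc i j)) ≤ capS P I Js i
    primary≤capS i with i ∈? I
    ... | yes i∈I rewrite []=⇒lookup i∈I =
      subst (_≤ ℕtoℚ (U ℕ.⊓ ∣ Js i ∣)) (sym (Σ-members (Js i) (1ℚ - ε)))
            (rate-fits ∣ Js i ∣ (∣p∣≤n (Js i)))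
    ... | no  i∉I rewrite ∉⇒outside i∉I = ≤-reflexive (Σ-zero n)

    Bounded : (Fin 3 → Fin n → ℚ) → Set
    Bounded φ = ∀ i j → 0ℚ ≤ φ i j × φ i j ≤ primary (arc i j)

    bounded-feasible : ∀ {cap φ} → Bounded φ → (∀ i → Σℚ n (φ i) ≤ cap i) →
                       (∀ j → Σℚ 3 (λ i → φ i j) ≤ 1ℚ) → FeasibleFlow P (Arc P I Js) cap φ
    bounded-feasible {φ = φ} bounded rows columns =
      (λ i j → proj₁ (bounded i j)) , off-arc , (λ i j → ≤-trans (proj₂ (bounded i j)) (primary≤1 (arc i j))) ,
      rows , columns
      where
      off-arc : ∀ i j → ¬ Arc P I Js i j → φ i j ≡ 0ℚ
      off-arc i j ¬a = ≤-antisym (subst (λ b → φ i j ≤ primary b) (no-Arc⇒no-arc ¬a) (proj₂ (bounded i j)))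
                                 (proj₁ (bounded i j))

    row≤primary : ∀ {φ} → Bounded φ → ∀ i → Σℚ n (φ i) ≤ Σℚ n (λ j → primary (arc i j))
    row≤primary bounded i = Σ-mono n (λ j → proj₂ (bounded i j))

    bounded⇒feasible : ∀ {φ} → Bounded φ → (∀ j → Σℚ 3 (λ i → φ i j) ≤ 1ℚ) →
                       FeasibleFlow P (Arc P I Js) (capS P I Js) φ
    bounded⇒feasible bounded =
      bounded-feasible bounded (λ i → ≤-trans (row≤primary bounded i) (primary≤capS i))

    bounded⇒feasible-without : ∀ r {φ} → Bounded φ → (∀ j → φ r j ≡ 0ℚ) →
                               (∀ j → Σℚ 3 (λ i → φ i j) ≤ 1ℚ) →
                               FeasibleFlow P (Arc P I Js) (capS-without P I Js r) φ
    bounded⇒feasible-without r {φ} bounded unused = bounded-feasible bounded rows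
      where
      rows : ∀ i → Σℚ n (φ i) ≤ capS-without P I Js r i
      rows i with r ≟ᶠ i
      ... | yes refl = ≤-reflexive (trans (Σ-cong n unused) (Σ-zero n))
      ... | no  _    = ≤-trans (row≤primary bounded i) (primary≤capS i)

    flowValue-by-client : ∀ φ → flowValue P φ ≡ Σℚ n (λ j → Σℚ 3 (λ i → φ i j))
    flowValue-by-client φ = Σ-swap 3 n φ

    covered : Fin n → Bool
    covered j = arc A j ∨ (arc B₁ j ∨ arc B₂ j)

    flow≤covered : ∀ {cap φ} → FeasibleFlow P (Arc P I Js) cap φ →
                   flowValue P φ ≤ Σℚ n (λ j → covered j · 1ℚ)
    flow≤covered {φ = φ} feasible =
      subst (_≤ Σℚ n (λ j → covered j · 1ℚ)) (sym (flowValue-by-client φ)) (Σ-mono n column)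
      where
      column≤1 : ∀ j → Σℚ 3 (λ i → φ i j) ≤ 1ℚ
      column≤1 = proj₂ (proj₂ (proj₂ (proj₂ feasible)))
      column-for : ∀ j a b₁ b₂ → arc A j ≡ a → arc B₁ j ≡ b₁ → arc B₂ j ≡ b₂ →
                   Σℚ 3 (λ i → φ i j) ≤ (a ∨ (b₁ ∨ b₂)) · 1ℚ
      column-for j true  _     _     _  _  _  = column≤1 j
      column-for j false true  _     _  _  _  = column≤1 j
      column-for j false false true  _  _  _  = column≤1 j
      column-for j false false false eA e₁ e₂ = ≤-reflexive
        (cong₂ _+_ (no-flow feasible eA) (cong₂ _+_ (no-flow feasible e₁) (cong (_+ 0ℚ) (no-flow feasible e₂))))
      column : ∀ j → Σℚ 3 (λ i → φ i j) ≤ covered j · 1ℚ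
      column j = column-for j (arc A j) (arc B₁ j) (arc B₂ j) refl refl refl

    by-rows : (Fin n → ℚ) → (Fin n → ℚ) → (Fin n → ℚ) → Fin 3 → Fin n → ℚ
    by-rows φA φ₁ φ₂ A  = φA
    by-rows φA φ₁ φ₂ B₁ = φ₁
    by-rows φA φ₁ φ₂ B₂ = φ₂

    without-B₁ without-B₂ : Fin 3 → Fin n → ℚ
    without-B₁ = by-rows (λ j → primary (arc A j)) (λ _ → 0ℚ) (λ j → backup (arc A j) (arc B₂ j))
    without-B₂ = by-rows (λ j → primary (arc A j)) (λ j → backup (arc A j) (arc B₁ j)) (λ _ → 0ℚ)

    without-B₁-bounded : Bounded without-B₁
    without-B₁-bounded A  j = 0≤primary (arc A j) , ≤-refl
    without-B₁-bounded B₁ j = ≤-refl , 0≤primary (arc B₁ j)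
    without-B₁-bounded B₂ j = backup-bounds (arc A j) (arc B₂ j)

    without-B₂-bounded : Bounded without-B₂
    without-B₂-bounded A  j = 0≤primary (arc A j) , ≤-refl
    without-B₂-bounded B₁ j = backup-bounds (arc A j) (arc B₁ j)
    without-B₂-bounded B₂ j = ≤-refl , 0≤primary (arc B₂ j)

    without-B₁-column : ∀ j → Σℚ 3 (λ i → without-B₁ i j) ≡ served (arc A j) (arc B₂ j)
    without-B₁-column j = drop-zeros (primary (arc A j)) (backup (arc A j) (arc B₂ j))
      where
      drop-zeros : ∀ p q → p + (0ℚ + (q + 0ℚ)) ≡ p + q
      drop-zeros = solve-∀ ringℚ

    without-B₂-column : ∀ j → Σℚ 3 (λ i → without-B₂ i j) ≡ served (arc A j) (arc B₁ j)
    without-B₂-column j = cong (primary (arc A j) +_) (+-identityʳ (backup (arc A j) (arc B₁ j)))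

    without-B₁-columns : ∀ j → Σℚ 3 (λ i → without-B₁ i j) ≤ 1ℚ
    without-B₁-columns j = subst (_≤ 1ℚ) (sym (without-B₁-column j)) (served≤1 (arc A j) (arc B₂ j))

    without-B₂-columns : ∀ j → Σℚ 3 (λ i → without-B₂ i j) ≤ 1ℚ
    without-B₂-columns j = subst (_≤ 1ℚ) (sym (without-B₂-column j)) (served≤1 (arc A j) (arc B₁ j))

    without-B₁-value : flowValue P without-B₁ ≡ Σℚ n (λ j → served (arc A j) (arc B₂ j))
    without-B₁-value = trans (flowValue-by-client without-B₁) (Σ-cong n without-B₁-column)

    without-B₂-value : flowValue P without-B₂ ≡ Σℚ n (λ j → served (arc A j) (arc B₁ j))
    without-B₂-value = trans (flowValue-by-client without-B₂) (Σ-cong n without-B₂-column)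

    x-part : ∀ (x : Fin 3 → Fin n → ℚ) → Σℚ 3 (λ i → ind I i * Σℚ n (λ j → ind (Js i) j * x i j))
                                         ≡ Σℚ n (λ j → Σℚ 3 (λ i → arc i j · x i j))
    x-part x = trans (Σ-cong 3 facility) (Σ-swap 3 n (λ i j → arc i j · x i j))
      where
      entry : ∀ i j → ind I i * (ind (Js i) j * x i j) ≡ arc i j · x i j
      entry i j = begin
        ind I i * (ind (Js i) j * x i j)           ≡⟨ cong (ind I i *_) (ind-* (Js i) j (x i j)) ⟩
        ind I i * (lookup (Js i) j · x i j)        ≡⟨ ind-* I i _ ⟩
        lookup I i · lookup (Js i) j · x i j       ≡⟨ ·-∧ (lookup I i) (lookup (Js i) j) (x i j) ⟩
        arc i j · x i j                            ∎
        where open ≡-Reasoning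
      facility : ∀ i → ind I i * Σℚ n (λ j → ind (Js i) j * x i j) ≡ Σℚ n (λ j → arc i j · x i j)
      facility i = trans (Σ-*ˡ n (ind I i) (λ j → ind (Js i) j * x i j)) (Σ-cong n (entry i))

    -- A is fully open in the LP solution, so only B₁, B₂ carry a ρ-term.
    ρ-part : ∀ fI (f₋ : Fin 3 → ℚ) → Σℚ 3 (λ i → ind I i * ((fI - f₋ i) * (1ℚ - yLP i))) ≡
             lookup I B₁ · ((fI - f₋ B₁) * xA) + lookup I B₂ · ((fI - f₋ B₂) * xA)
    ρ-part fI f₋ = trans (drop-A (ind I A) fI (f₋ A) (ind I B₁ * _) (ind I B₂ * _))
                         (cong₂ _+_ (ind-* I B₁ _) (ind-* I B₂ _))
      where
      drop-A : ∀ a g h r s → a * ((g - h) * (1ℚ - 1ℚ)) + (r + (s + 0ℚ)) ≡ r + s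
      drop-A = solve-∀ ringℚ

    module _ (fI : ℚ) (f₋ : Fin 3 → ℚ)
             (max-I : IsMaxFlow P (Arc P I Js) (capS P I Js) fI)
             (max-I₋ : ∀ i → i ∈ I → IsMaxFlow P (Arc P I Js) (capS-without P I Js i) (f₋ i)) where

      load-at flow₋₁-at flow₋₂-at covered-at : Fin n → ℚ
      load-at j    = load (arc A j) (arc B₁ j) (arc B₂ j)
      flow₋₁-at j  = served (arc A j) (arc B₂ j)
      flow₋₂-at j  = served (arc A j) (arc B₁ j)
      covered-at j = covered j · 1ℚ

      SX V₁ V₂ C : ℚ
      SX = Σℚ n load-at
      V₁ = Σℚ n flow₋₁-at
      V₂ = Σℚ n flow₋₂-at
      C  = Σℚ n covered-at

      V₁≤fI : V₁ ≤ fI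
      V₁≤fI = subst (_≤ fI) without-B₁-value
                (proj₂ max-I without-B₁ (bounded⇒feasible without-B₁-bounded without-B₁-columns))

      V₂≤fI : V₂ ≤ fI
      V₂≤fI = subst (_≤ fI) without-B₂-value
                (proj₂ max-I without-B₂ (bounded⇒feasible without-B₂-bounded without-B₂-columns))

      V₁≤f₋B₁ : B₁ ∈ I → V₁ ≤ f₋ B₁
      V₁≤f₋B₁ B₁∈I = subst (_≤ f₋ B₁) without-B₁-value (proj₂ (max-I₋ B₁ B₁∈I) without-B₁
        (bounded⇒feasible-without B₁ without-B₁-bounded (λ _ → refl) without-B₁-columns))

      V₂≤f₋B₂ : B₂ ∈ I → V₂ ≤ f₋ B₂
      V₂≤f₋B₂ B₂∈I = subst (_≤ f₋ B₂) without-B₂-value (proj₂ (max-I₋ B₂ B₂∈I) without-B₂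
        (bounded⇒feasible-without B₂ without-B₂-bounded (λ _ → refl) without-B₂-columns))

      fI≤C : fI ≤ C
      fI≤C = let (φ , feasible , value) = proj₁ max-I in subst (_≤ C) value (flow≤covered feasible)

      r₁ r₂ : ℚ
      r₁ = (fI - f₋ B₁) * xA
      r₂ = (fI - f₋ B₂) * xA

      both-in-I : B₁ ∈ I → B₂ ∈ I → SX + (r₁ + r₂) ≤ fI
      both-in-I B₁∈I B₂∈I =
        two-facilities-bound {y = yB} {S = SX} 0≤xA 0≤1-2yB
                             (V₁≤f₋B₁ B₁∈I) (V₂≤f₋B₂ B₂∈I) fI≤C summed
        where
        k : ℚ
        k = 1ℚ - (yB + yB)
        summed : SX + k * C ≤ xA * V₁ + xA * V₂
        summed = subst₂ _≤_ (trans (Σ-+ n load-at (λ j → k * covered-at j))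
                                   (cong (SX +_) (sym (Σ-*ˡ n k covered-at))))
                            (Σ-linear n xA xA flow₋₁-at flow₋₂-at)
                            (Σ-mono n (λ j → load-both (arc A j) (arc B₁ j) (arc B₂ j)))

      only-B₁-in-I : B₁ ∈ I → lookup I B₂ ≡ false → SX + r₁ ≤ fI
      only-B₁-in-I B₁∈I B₂∉I = one-facility-bound {S = SX} 0≤yB 0≤xA (V₁≤f₋B₁ B₁∈I) V₂≤fI summed
        where
        client : ∀ a b₁ b₂ → b₂ ≡ false → load a b₁ b₂ ≤ yB * served a b₁ + xA * served a b₂
        client a b₁ .false refl = load-one a b₁
        summed : SX ≤ yB * V₂ + xA * V₁
        summed = subst (SX ≤_) (Σ-linear n yB xA flow₋₂-at flow₋₁-at)
                   (Σ-mono n (λ j → client (arc A j) (arc B₁ j) (arc B₂ j) (outside⇒no-arc B₂∉I j)))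

      only-B₂-in-I : lookup I B₁ ≡ false → B₂ ∈ I → SX + r₂ ≤ fI
      only-B₂-in-I B₁∉I B₂∈I = one-facility-bound {S = SX} 0≤yB 0≤xA (V₂≤f₋B₂ B₂∈I) V₁≤fI summed
        where
        client : ∀ a b₁ b₂ → b₁ ≡ false → load a b₁ b₂ ≤ yB * served a b₂ + xA * served a b₁
        client a .false b₂ refl = subst (_≤ yB * served a b₂ + xA * served a false)
                                        (cong (a · xA +_) (sym (+-identityˡ (b₂ · ε + 0ℚ)))) (load-one a b₂)
        summed : SX ≤ yB * V₁ + xA * V₂
        summed = subst (SX ≤_) (Σ-linear n yB xA flow₋₁-at flow₋₂-at)
                   (Σ-mono n (λ j → client (arc A j) (arc B₁ j) (arc B₂ j) (outside⇒no-arc B₁∉I j)))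

      neither-in-I : lookup I B₁ ≡ false → lookup I B₂ ≡ false → SX ≤ fI
      neither-in-I B₁∉I B₂∉I = ≤-trans (Σ-mono n {load-at} {flow₋₁-at} pointwise) V₁≤fI
        where
        client : ∀ a b₁ b₂ → b₁ ≡ false → b₂ ≡ false → load a b₁ b₂ ≤ served a b₂
        client a .false .false refl refl = load-none a
        pointwise : ∀ j → load-at j ≤ flow₋₁-at j
        pointwise j = client (arc A j) (arc B₁ j) (arc B₂ j) (outside⇒no-arc B₁∉I j) (outside⇒no-arc B₂∉I j)

      inequality : SX + (lookup I B₁ · r₁ + lookup I B₂ · r₂) ≤ fI
      inequality = by-case (lookup I B₁) (lookup I B₂) refl refl
        where
        by-case : ∀ β₁ β₂ → lookup I B₁ ≡ β₁ → lookup I B₂ ≡ β₂ →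
                  SX + (β₁ · r₁ + β₂ · r₂) ≤ fI
        by-case true  true  e₁ e₂ = both-in-I (lookup⇒[]= B₁ I e₁) (lookup⇒[]= B₂ I e₂)
        by-case true  false e₁ e₂ = subst (_≤ fI) (cong (SX +_) (sym (+-identityʳ r₁)))
                                          (only-B₁-in-I (lookup⇒[]= B₁ I e₁) e₂)
        by-case false true  e₁ e₂ = subst (_≤ fI) (cong (SX +_) (sym (+-identityˡ r₂)))
                                          (only-B₂-in-I e₁ (lookup⇒[]= B₂ I e₂))
        by-case false false e₁ e₂ = subst (_≤ fI) (sym (+-identityʳ SX)) (neither-in-I e₁ e₂)

  LP-submodular : SatisfiesSubmodular P yLP xLP
  LP-submodular I _ Js _ fI f₋ max-I max-I₋ =
    subst (_≤ fI) (sym (cong₂ _+_ (x-part xLP) (ρ-part fI f₋))) (inequality fI f₋ max-I max-I₋)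
    where open Network I Js

  K*LP-cost<1 : ∀ K → 4 ℕ.* K ℕ.≤ U → ℕtoℚ K * cost P yLP xLP < 1ℚ
  K*LP-cost<1 K 4K≤U = begin-strict
    ℕtoℚ K * cost P yLP xLP      ≡⟨ cong (ℕtoℚ K *_) (cost≡ yLP xLP) ⟩
    ℕtoℚ K * (yB + yB)           ≡⟨ regroup (ℕtoℚ K) ε ⟩
    ℕtoℚ 4 * ℕtoℚ K * ε          ≡⟨ cong (_* ε) (sym (ℕtoℚ-* 4 K)) ⟩
    ℕtoℚ (4 ℕ.* K) * ε           ≤⟨ *-monoʳ-≤-nonNeg ε {{nonNegative ε≥0}} (ℕtoℚ-mono 4K≤U) ⟩
    u * ε                        ≡⟨ mod-[1+u]ε 1ℚ (identity u ε) ⟩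
    1ℚ - ε                       <⟨ drop-ε ⟩
    1ℚ                           ∎
    where
    open ≤-Reasoning
    regroup : ∀ k e → k * ((e + e) + (e + e)) ≡ ((1ℚ + 1ℚ) + (1ℚ + 1ℚ)) * k * e
    regroup = solve-∀ ringℚ
    identity : ∀ u e → u * e ≡ (1ℚ - e) + 1ℚ * ((1ℚ + u) * e - 1ℚ)
    identity = solve-∀ ringℚ
    drop-ε : 1ℚ - ε < 1ℚ
    drop-ε = subst₂ _<_ (+-identityʳ (1ℚ - ε)) (restore ε) (+-monoʳ-< (1ℚ - ε) ε>0)
      where
      restore : ∀ e → (1ℚ - e) + e ≡ 1ℚ
      restore = solve-∀ ringℚ

theorem5 : (K : ℕ) →
    Σ Instance (λ P →
      Σ (Fin (Instance.nF P) → ℚ) (λ y →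
        Σ (Fin (Instance.nF P) → Fin (Instance.nC P) → ℚ) (λ x →
          LPFeasible P y x × SatisfiesSubmodular P y x ×
          Σ (Fin (Instance.nF P) → ℚ) (λ y' → Σ (Fin (Instance.nF P) → Fin (Instance.nC P) → ℚ) (λ x' → IntFeasible P y' x')) ×
          (∀ y' x' → IntFeasible P y' x' → ℕtoℚ K * cost P y x < cost P y' x'))))
theorem5 K = P , yLP , xLP , LP-feasible , LP-submodular , (yInt , xInt , Int-feasible) , gap
  where
  open GapInstance (3 ℕ.+ 4 ℕ.* K) (ℕ.m≤m+n 3 (4 ℕ.* K))
  gap : ∀ y x → IntFeasible P y x → ℕtoℚ K * cost P yLP xLP < cost P y x
  gap y x integral = <-≤-trans (K*LP-cost<1 K (ℕ.m≤n+m (4 ℕ.* K) 3)) (integral-cost≥1 y x integral)
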